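{- Let $G$ be an abelian group of odd order and let $\{A,B,C\}$ be a rainbow-free $3$-coloring of $G$ with non-empty color classes. If $|A|=2$, then the coloring is $H$-regular for some proper subgroup $H<G$.
   Context: A $3$-term arithmetic progression is a triple $(x,y,z)\in G^3$ with $x+y=2z$; it is rainbow if its members lie in pairwise distinct color classes; a coloring is rainbow-free if there is none. A set $S$ is $H$-periodic if $S+H=S$; $2\cdot X=\{2x:x\in X\}$, $-X=\{ -x\}$. For a proper subgroup $H$ of $G$, the coloring is $H$-regular if there exist $g\in G$ and a labelling $A',B',C'$ of the color classes of the translated coloring $x\mapsto c(x+g)$ such that: (i) $A'\subseteq H$ and the coloring induced on $H$ is rainbow-free; (ii) $B'\setminus H$ and $C'\setminus H$ are $H$-periodic; (iii) $\widetilde B=B'\setminus H$, $\widetilde C=C'\setminus H$ satisfy $\widetilde{B}=-\widetilde{B}=2\cdot\widetilde{B}$ and $\widetilde{C}=-\widetilde{C}=2\cdot\widetilde{C}$. -}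

module Defs where

open import Level using (Level; _⊔_)
open import Algebra.Bundles using (AbelianGroup)
open import Data.Nat using (ℕ; suc; _*_)
open import Data.Fin using (Fin)
open import Data.List using (List; length)
open import Data.Product using (Σ; ∃; _×_; _,_)
open import Data.Sum using (_⊎_)
open import Relation.Nullary using (¬_)
open import Relation.Binary.PropositionalEquality using (_≡_; _≢_)
import Data.List.Membership.Setoid as SetoidMembership
import Data.List.Relation.Unary.Unique.Setoid as SetoidUnique

module _ {c ℓ : Level} (G : AbelianGroup c ℓ) where
  open AbelianGroup G renaming (_∙_ to _+_; ε to 0#; _⁻¹ to -_)
  open SetoidMembership setoid using (_∈_)
  open SetoidUnique setoid using (Unique)

  HasOrder : ℕ → Set (c ⊔ ℓ)
  HasOrder n = Σ (List Carrier) λ xs →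
    Unique xs × (∀ x → x ∈ xs) × length xs ≡ n

  FiniteOddOrder : Set (c ⊔ ℓ)
  FiniteOddOrder = Σ ℕ λ k → HasOrder (suc (2 * k))

  Coloring : Set (c ⊔ ℓ)
  Coloring = Σ (Carrier → Fin 3) λ col → ∀ {x y} → x ≈ y → col x ≡ col y

  Rainbow3 : Fin 3 → Fin 3 → Fin 3 → Set
  Rainbow3 i j k = i ≢ j × i ≢ k × j ≢ k

  IsAP : Carrier → Carrier → Carrier → Set ℓ
  IsAP x y z = x + y ≈ z + z

  RainbowFree : (Carrier → Fin 3) → Set (c ⊔ ℓ)
  RainbowFree col = ∀ x y z → IsAP x y z → ¬ Rainbow3 (col x) (col y) (col z)

  RainbowFreeOn : (Carrier → Set ℓ) → (Carrier → Fin 3) → Set (c ⊔ ℓ)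
  RainbowFreeOn H col = ∀ x y z → H x → H y → H z →
    IsAP x y z → ¬ Rainbow3 (col x) (col y) (col z)

  AllClassesNonEmpty : (Carrier → Fin 3) → Set c
  AllClassesNonEmpty col = ∀ i → ∃ λ x → col x ≡ i

  ClassHasSize2 : (Carrier → Fin 3) → Fin 3 → Set (c ⊔ ℓ)
  ClassHasSize2 col i = Σ Carrier λ x → Σ Carrier λ y →
    ¬ (x ≈ y) × col x ≡ i × col y ≡ i × (∀ z → col z ≡ i → z ≈ x ⊎ z ≈ y)

  record IsSubgroup (H : Carrier → Set ℓ) : Set (c ⊔ ℓ) where
    field
      resp  : ∀ {x y} → x ≈ y → H x → H y
      zero∈ : H 0#
      +-closed : ∀ {x y} → H x → H y → H (x + y)
      neg-closed : ∀ {x} → H x → H (- x)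

  IsProperSubgroup : (Carrier → Set ℓ) → Set (c ⊔ ℓ)
  IsProperSubgroup H = IsSubgroup H × (∃ λ x → ¬ H x)

  -- Set operations on predicates.
  -- S + H ⊆ S (equivalent to S + H = S since 0 ∈ H).
  Periodic : (Carrier → Set ℓ) → (Carrier → Set ℓ) → Set (c ⊔ ℓ)
  Periodic H S = ∀ x h → S x → H h → S (x + h)

  Symmetric : (Carrier → Set ℓ) → Set (c ⊔ ℓ)
  Symmetric S = (∀ x → S x → S (- x)) × (∀ x → S (- x) → S x)

  DoublingInvariant : (Carrier → Set ℓ) → Set (c ⊔ ℓ)
  DoublingInvariant S = (∀ x → S x → S (x + x))
                      × (∀ y → S y → ∃ λ x → S x × x + x ≈ y)

  HRegular : (Carrier → Set ℓ) → (Carrier → Fin 3) → Set (c ⊔ ℓ)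
  HRegular H col = Σ Carrier λ g → Σ (Fin 3) λ a′ → Σ (Fin 3) λ b′ → Σ (Fin 3) λ c′ →
    let col′ : Carrier → Fin 3
        col′ x = col (x + g)
        B~ : Carrier → Set ℓ
        B~ x = (col′ x ≡ b′) × ¬ H x
        C~ : Carrier → Set ℓ
        C~ x = (col′ x ≡ c′) × ¬ H x
    in Rainbow3 a′ b′ c′
     × (∀ x → col′ x ≡ a′ → H x)
     × RainbowFreeOn H col′
     × Periodic H B~ × Periodic H C~
     × Symmetric B~ × DoublingInvariant B~
     × Symmetric C~ × DoublingInvariant C~

-- Translate the colouring so that the two-element class becomes {e, -e} (possible because
-- halving is defined in a group of odd order), and let C be a class other than this one and
-- the class of 0.  Rainbow-freeness forces C + 2e ⊆ C and C - 2e ⊆ C, so 2e and hence e lie in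
-- the stabiliser H of C, which is a proper subgroup because C is non-empty and e ∉ C.  Outside H
-- the colour is then decided by membership in C, so every class minus H is H-periodic, and the
-- progressions (x, 2e - x, e) and (-e, 2x + e, x) make it symmetric and closed under doubling.
module Submission where

open import Level using (Level; 0ℓ; Lift; lift)
open import Algebra.Bundles using (AbelianGroup)
open import Data.Empty using (⊥-elim)
open import Data.Fin using (Fin; zero; suc)
open import Data.Fin.Permutation using (Permutation; permutation)
open import Data.Fin.Properties using (_≟_; all?; any?)
open import Data.List using (List; lookup)
import Data.List.Relation.Unary.All as All
open import Data.List.Relation.Unary.AllPairs using (_∷_)
open import Data.List.Relation.Unary.Any using (index)
open import Data.List.Relation.Unary.Any.Properties using (lookup-index)
open import Data.List.Membership.Propositional.Properties using (∈-lookup)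
open import Data.Nat as ℕ using (ℕ; zero; suc; _*_)
open import Data.Nat.Properties using (+-suc; +-identityʳ)
open import Data.Product using (Σ; ∃; _×_; _,_; proj₁; proj₂)
open import Data.Sum using (_⊎_; inj₁; inj₂)
open import Function using (_∘_)
open import Function.Bundles using (_⇔_; mk⇔; module Equivalence)
open import Function.Properties.Equivalence using (⇔-isEquivalence)
open import Relation.Binary.Structures using (module IsEquivalence)
open import Relation.Nullary using (¬_; yes; no)
open import Relation.Nullary.Decidable using (toWitness; decidable-stable; ¬?; _×-dec_; _→-dec_)
open import Relation.Binary.PropositionalEquality as ≡ using (_≡_; _≢_; refl; ≢-sym)
import Data.List.Membership.Setoid as SetoidMembership
import Data.List.Relation.Unary.Unique.Setoid as SetoidUnique
open import Defs

open Equivalence using (to; from)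
open IsEquivalence (⇔-isEquivalence {ℓ = 0ℓ}) using () renaming (sym to ⇔-sym; trans to ⇔-trans)

∃≢₂ : (i j : Fin 3) → ∃ λ k → k ≢ i × k ≢ j
∃≢₂ = toWitness {a? = all? λ i → all? λ j → any? λ k → ¬? (k ≟ i) ×-dec ¬? (k ≟ j)} _

≢₂-unique : ∀ {i j k l : Fin 3} → i ≢ j → k ≢ i → k ≢ j → l ≢ i → l ≢ j → l ≡ k
≢₂-unique {i} {j} {k} {l} = toWitness {a? = all? λ i → all? λ j → all? λ k → all? λ l →
  ¬? (i ≟ j) →-dec ¬? (k ≟ i) →-dec ¬? (k ≟ j) →-dec ¬? (l ≟ i) →-dec ¬? (l ≟ j) →-dec l ≟ k}
  _ i j k l

module _ {g₀ ℓ : Level} (G : AbelianGroup g₀ ℓ) where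
  open AbelianGroup G renaming (_∙_ to _+_; ε to 0#; _⁻¹ to -_; refl to ≈-refl)
  open import Algebra.Properties.Group group
    using ( ε⁻¹≈ε; ⁻¹-involutive; ⁻¹-injective; ∙-cancelʳ; identityˡ-unique; identityʳ-unique
          ; x≈z//y; //-rightDividesˡ; //-rightDividesʳ; \\-leftDividesˡ; \\-leftDividesʳ)
  open import Algebra.Properties.AbelianGroup G using (⁻¹-∙-comm)
  open import Algebra.Properties.CommutativeSemigroup commutativeSemigroup
    using (interchange; x∙yz≈y∙xz)
  open import Algebra.Properties.CommutativeMonoid.Mult commutativeMonoid
    using (×-cong; ×-homo-+; ×-distrib-+) renaming (_×_ to _·_)
  open import Algebra.Properties.CommutativeMonoid.Sum commutativeMonoid
    using (sum; sum-permute; sum-cong-≋; sum-replicate; ∑-distrib-+)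
  open SetoidMembership setoid using (_∈_)
  open SetoidUnique setoid using (Unique)
  open import Relation.Binary.Reasoning.Setoid setoid

  ¬rainbow⇒≡₂₃ : ∀ {i j k} → ¬ Rainbow3 G i j k → i ≢ j → i ≢ k → j ≡ k
  ¬rainbow⇒≡₂₃ {j = j} {k} nr i≢j i≢k = decidable-stable (j ≟ k) (λ j≢k → nr (i≢j , i≢k , j≢k))

  ¬rainbow⇒≡₁₃ : ∀ {i j k} → ¬ Rainbow3 G i j k → i ≢ j → j ≢ k → i ≡ k
  ¬rainbow⇒≡₁₃ {i} {k = k} nr i≢j j≢k = decidable-stable (i ≟ k) (λ i≢k → nr (i≢j , i≢k , j≢k))

  ¬rainbow⇒≡₁₂ : ∀ {i j k} → ¬ Rainbow3 G i j k → i ≢ k → j ≢ k → i ≡ j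
  ¬rainbow⇒≡₁₂ {i} {j} nr i≢k j≢k = decidable-stable (i ≟ j) (λ i≢j → nr (i≢j , i≢k , j≢k))

  ¬rainbow-cong : ∀ {i j k i′ j′ k′} → i ≡ i′ → j ≡ j′ → k ≡ k′ →
                  ¬ Rainbow3 G i j k → ¬ Rainbow3 G i′ j′ k′
  ¬rainbow-cong refl refl refl nr = nr

  rainbowFree-translate : ∀ {col} g → RainbowFree G col → RainbowFree G (λ x → col (x + g))
  rainbowFree-translate g rf x y z x+y≈2z = rf (x + g) (y + g) (z + g) (begin
    (x + g) + (y + g)  ≈⟨ interchange x g y g ⟩
    (x + y) + (g + g)  ≈⟨ ∙-congʳ x+y≈2z ⟩
    (z + z) + (g + g)  ≈⟨ interchange z z g g ⟩
    (z + g) + (z + g)  ∎)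

  lookup-injective : ∀ {xs} → Unique xs → ∀ i j → lookup xs i ≈ lookup xs j → i ≡ j
  lookup-injective (_ ∷ _)  zero    zero    _  = refl
  lookup-injective (x∉ ∷ _) zero    (suc j) eq = ⊥-elim (All.lookup x∉ (∈-lookup j) eq)
  lookup-injective (x∉ ∷ _) (suc i) zero    eq = ⊥-elim (All.lookup x∉ (∈-lookup i) (sym eq))
  lookup-injective (_ ∷ u)  (suc i) (suc j) eq = ≡.cong suc (lookup-injective u i j eq)

  -- Translation by x permutes the enumeration, so it fixes the sum of all elements.
  order-annihilates : ∀ {n} → HasOrder G n → ∀ x → n · x ≈ 0#
  order-annihilates {n} (xs , unique , complete , refl) x =
    identityˡ-unique (n · x) (sum elem) (sym sum-shifted)
    where
    elem : Fin n → Carrier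
    elem = lookup xs

    shift : Carrier → Fin n → Fin n
    shift t i = index (complete (t + elem i))

    elem-shift : ∀ t i → t + elem i ≈ elem (shift t i)
    elem-shift t i = lookup-index (complete (t + elem i))

    shift-cancel : ∀ s t → s + t ≈ 0# → ∀ i → shift s (shift t i) ≡ i
    shift-cancel s t s+t≈0 i = lookup-injective unique _ _ (begin
      elem (shift s (shift t i))  ≈⟨ elem-shift s (shift t i) ⟨
      s + elem (shift t i)        ≈⟨ ∙-congˡ (elem-shift t i) ⟨
      s + (t + elem i)            ≈⟨ assoc s t (elem i) ⟨
      (s + t) + elem i            ≈⟨ ∙-congʳ s+t≈0 ⟩
      0# + elem i                 ≈⟨ identityˡ (elem i) ⟩
      elem i                      ∎)

    sum-shifted : sum elem ≈ n · x + sum elem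
    sum-shifted = begin
      sum elem                      ≈⟨ sum-permute elem shift-by-x ⟩
      sum (λ i → elem (shift x i))  ≈⟨ sum-cong-≋ (λ i → elem-shift x i) ⟨
      sum (λ i → x + elem i)        ≈⟨ ∑-distrib-+ (λ _ → x) elem ⟩
      sum {n} (λ _ → x) + sum elem  ≈⟨ ∙-congʳ (sum-replicate n) ⟩
      n · x + sum elem              ∎
      where
      shift-by-x : Permutation n n
      shift-by-x = permutation (shift x) (shift (- x))
                     (shift-cancel x (- x) (inverseʳ x)) (shift-cancel (- x) x (inverseˡ x))

  module SubgroupProperties {H : Carrier → Set ℓ} (H-subgroup : IsSubgroup G H) where
    open IsSubgroup H-subgroup

    ·-closed : ∀ {x} → H x → ∀ m → H (m · x)
    ·-closed x∈H zero    = zero∈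
    ·-closed x∈H (suc m) = +-closed x∈H (·-closed x∈H m)

    ∉-+-closed : ∀ {x h} → ¬ H x → H h → ¬ H (x + h)
    ∉-+-closed {x} {h} x∉H h∈H x+h∈H =
      x∉H (resp (//-rightDividesʳ h x) (+-closed x+h∈H (neg-closed h∈H)))

    ∉-neg-closed : ∀ {x} → ¬ H x → ¬ H (- x)
    ∉-neg-closed {x} x∉H −x∈H = x∉H (resp (⁻¹-involutive x) (neg-closed −x∈H))

  module Halving (k : ℕ) (odd-order : ∀ x → suc (2 * k) · x ≈ 0#) where
    half : Carrier → Carrier
    half x = suc k · x

    half+half : ∀ x → half x + half x ≈ x
    half+half x = begin
      half x + half x        ≈⟨ ×-homo-+ x (suc k) (suc k) ⟨
      (suc k ℕ.+ suc k) · x  ≈⟨ ×-cong 1+k+1+k≡2+2k ≈-refl ⟩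
      x + suc (2 * k) · x    ≈⟨ ∙-congˡ (odd-order x) ⟩
      x + 0#                 ≈⟨ identityʳ x ⟩
      x                      ∎
      where
      1+k+1+k≡2+2k : suc k ℕ.+ suc k ≡ suc (suc (2 * k))
      1+k+1+k≡2+2k = ≡.cong suc (≡.trans (+-suc k k)
                       (≡.cong (λ t → suc (k ℕ.+ t)) (≡.sym (+-identityʳ k))))

    half-double : ∀ x → half (x + x) ≈ x
    half-double x = trans (×-distrib-+ x x (suc k)) (half+half x)

    halve-closed : ∀ {H} → IsSubgroup G H → ∀ {x} → H (x + x) → H x
    halve-closed H-subgroup {x} 2x∈H =
      IsSubgroup.resp H-subgroup (half-double x) (·-closed 2x∈H (suc k))
      where open SubgroupProperties H-subgroup

  -- Quantifying over the positions of a complete list rather than over Carrier keeps the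
  -- stabiliser in Set ℓ.
  module Stabiliser (xs : List Carrier) (complete : ∀ x → x ∈ xs)
                    (S : Carrier → Set) (S-resp : ∀ {x y} → x ≈ y → S x → S y) where
    Stab : Carrier → Set ℓ
    Stab h = Lift ℓ (∀ i → S (lookup xs i) ⇔ S (lookup xs i + h))

    S-cong : ∀ {x y} → x ≈ y → S x ⇔ S y
    S-cong x≈y = mk⇔ (S-resp x≈y) (S-resp (sym x≈y))

    stab-intro : ∀ {h} → (∀ z → S z ⇔ S (z + h)) → Stab h
    stab-intro stable = lift (λ i → stable (lookup xs i))

    stab-elim : ∀ {h} → Stab h → ∀ z → S z ⇔ S (z + h)
    stab-elim (lift stable) z =
      ⇔-trans (S-cong z≈) (⇔-trans (stable (index (complete z))) (S-cong (∙-congʳ (sym z≈))))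
      where
      z≈ : z ≈ lookup xs (index (complete z))
      z≈ = lookup-index (complete z)

    stab-isSubgroup : IsSubgroup G Stab
    stab-isSubgroup = record
      { resp       = λ x≈y x∈S → stab-intro λ z →
                       ⇔-trans (stab-elim x∈S z) (S-cong (∙-congˡ x≈y))
      ; zero∈      = stab-intro λ z → S-cong (sym (identityʳ z))
      ; +-closed   = λ {x} {y} x∈S y∈S → stab-intro λ z →
                       ⇔-trans (stab-elim x∈S z)
                               (⇔-trans (stab-elim y∈S (z + x)) (S-cong (assoc z x y)))
      ; neg-closed = λ {x} x∈S → stab-intro λ z →
                       ⇔-trans (S-cong (sym (//-rightDividesˡ x z)))
                               (⇔-sym (stab-elim x∈S (z + - x)))
      }

  module TwoElementClass
    (k : ℕ) (odd-order : ∀ x → suc (2 * k) · x ≈ 0#) (xs : List Carrier) (complete : ∀ x → x ∈ xs)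
    (col₀ : Carrier → Fin 3) (col₀-resp : ∀ {x y} → x ≈ y → col₀ x ≡ col₀ y)
    (rf₀ : RainbowFree G col₀) (nonempty₀ : AllClassesNonEmpty G col₀)
    (a : Fin 3) (x₀ y₀ : Carrier) (x₀≉y₀ : ¬ x₀ ≈ y₀) (col-x₀ : col₀ x₀ ≡ a) (col-y₀ : col₀ y₀ ≡ a)
    (class₀ : ∀ z → col₀ z ≡ a → z ≈ x₀ ⊎ z ≈ y₀) where

    open Halving k odd-order

    g e : Carrier
    g = half (x₀ + y₀)
    e = y₀ + - g

    col : Carrier → Fin 3
    col x = col₀ (x + g)

    col-resp : ∀ {x y} → x ≈ y → col x ≡ col y
    col-resp x≈y = col₀-resp (∙-congʳ x≈y)

    rf : RainbowFree G col
    rf = rainbowFree-translate g rf₀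

    e+g≈y₀ : e + g ≈ y₀
    e+g≈y₀ = //-rightDividesˡ g y₀

    −e+g≈x₀ : - e + g ≈ x₀
    −e+g≈x₀ = begin
      - (y₀ + - g) + g    ≈⟨ ∙-congʳ (⁻¹-∙-comm y₀ (- g)) ⟨
      (- y₀ + - - g) + g  ≈⟨ ∙-congʳ (∙-congˡ (⁻¹-involutive g)) ⟩
      (- y₀ + g) + g      ≈⟨ assoc (- y₀) g g ⟩
      - y₀ + (g + g)      ≈⟨ ∙-congˡ (trans (half+half (x₀ + y₀)) (comm x₀ y₀)) ⟩
      - y₀ + (y₀ + x₀)    ≈⟨ \\-leftDividesʳ y₀ x₀ ⟩
      x₀                  ∎

    e≉0 : ¬ e ≈ 0#
    e≉0 e≈0 = x₀≉y₀ (begin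
      x₀      ≈⟨ −e+g≈x₀ ⟨
      - e + g ≈⟨ ∙-congʳ (trans (⁻¹-cong e≈0) ε⁻¹≈ε) ⟩
      0# + g  ≈⟨ ∙-congʳ e≈0 ⟨
      e + g   ≈⟨ e+g≈y₀ ⟩
      y₀      ∎)

    −e≉0 : ¬ - e ≈ 0#
    −e≉0 −e≈0 = e≉0 (⁻¹-injective (trans −e≈0 (sym ε⁻¹≈ε)))

    col-e : col e ≡ a
    col-e = ≡.trans (col₀-resp e+g≈y₀) col-y₀

    col-−e : col (- e) ≡ a
    col-−e = ≡.trans (col₀-resp −e+g≈x₀) col-x₀

    col-−−e : col (- - e) ≡ a
    col-−−e = ≡.trans (col-resp (⁻¹-involutive e)) col-e

    class-e : ∀ z → col z ≡ a → z ≈ e ⊎ z ≈ - e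
    class-e z col-z with class₀ (z + g) col-z
    ... | inj₁ z+g≈x₀ = inj₂ (∙-cancelʳ g z (- e) (trans z+g≈x₀ (sym −e+g≈x₀)))
    ... | inj₂ z+g≈y₀ = inj₁ (∙-cancelʳ g z e (trans z+g≈y₀ (sym e+g≈y₀)))

    class-−e : ∀ z → col z ≡ a → z ≈ - e ⊎ z ≈ - - e
    class-−e z col-z with class-e z col-z
    ... | inj₁ z≈e  = inj₂ (trans z≈e (sym (⁻¹-involutive e)))
    ... | inj₂ z≈−e = inj₁ z≈−e

    b : Fin 3
    b = col 0#

    b≢a : b ≢ a
    b≢a col-0 with class-e 0# col-0
    ... | inj₁ 0≈e  = e≉0 (sym 0≈e)
    ... | inj₂ 0≈−e = −e≉0 (sym 0≈−e)

    c : Fin 3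
    c = proj₁ (∃≢₂ a b)

    c≢a : c ≢ a
    c≢a = proj₁ (proj₂ (∃≢₂ a b))

    c≢b : c ≢ b
    c≢b = proj₂ (proj₂ (∃≢₂ a b))

    C : Carrier → Set
    C x = col x ≡ c

    C-resp : ∀ {x y} → x ≈ y → C x → C y
    C-resp x≈y = ≡.trans (col-resp (sym x≈y))

    module Generator (u : Carrier) (u≉0 : ¬ u ≈ 0#) (col-u : col u ≡ a) (col-−u : col (- u) ≡ a)
                     (class-u : ∀ z → col z ≡ a → z ≈ u ⊎ z ≈ - u) where
      -- If 3u ∈ C, the progression (3u, u, 2u) puts 2u in C, and then (0, 2u, u) is rainbow.
      triple∉C : ¬ C (u + u + u)
      triple∉C 3u∈C =
        ¬rainbow-cong refl 2u∈C col-u (rf 0# (u + u) u (identityˡ (u + u))) (≢-sym c≢b , b≢a , c≢a)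
        where
        col-2u≢a : col (u + u) ≢ a
        col-2u≢a col-2u with class-u (u + u) col-2u
        ... | inj₁ 2u≈u  = u≉0 (identityʳ-unique u u 2u≈u)
        ... | inj₂ 2u≈−u = c≢b (≡.trans (≡.sym 3u∈C) (col-resp (trans (∙-congʳ 2u≈−u) (inverseˡ u))))

        2u∈C : C (u + u)
        2u∈C = ≡.sym (¬rainbow⇒≡₁₃
          (¬rainbow-cong 3u∈C col-u refl (rf (u + u + u) u (u + u) (assoc (u + u) u u)))
          c≢a (≢-sym col-2u≢a))

      -- The progressions (u, z, x) and (-u, z + 2u, x) with 2x = z + u carry C from z to z + 2u.
      C+double : ¬ C (- u + - u + - u) → ∀ z → C z → C (z + (u + u))
      C+double −3u∉C z z∈C = ¬rainbow⇒≡₂₃ (¬rainbow-cong col-−u refl x∈C (rf (- u) w x −u+w≈2x))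
                                          (≢-sym col-w≢a) (≢-sym c≢a)
        where
        x w : Carrier
        x = half (z + u)
        w = z + (u + u)

        2x≈z+u : x + x ≈ z + u
        2x≈z+u = half+half (z + u)

        −u+w≈2x : - u + w ≈ x + x
        −u+w≈2x = begin
          - u + (z + (u + u))  ≈⟨ x∙yz≈y∙xz (- u) z (u + u) ⟩
          z + (- u + (u + u))  ≈⟨ ∙-congˡ (\\-leftDividesʳ u u) ⟩
          z + u                ≈⟨ 2x≈z+u ⟨
          x + x                ∎

        −2u≈−u−u : - (u + u) ≈ - u + - u
        −2u≈−u−u = sym (⁻¹-∙-comm u u)

        z∉A : col z ≢ a
        z∉A col-z = c≢a (≡.trans (≡.sym z∈C) col-z)

        col-x≢a : col x ≢ a
        col-x≢a col-x with class-u x col-x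
        ... | inj₁ x≈u  =
          z∉A (≡.trans (col-resp (∙-cancelʳ u z u (trans (sym 2x≈z+u) (∙-cong x≈u x≈u)))) col-u)
        ... | inj₂ x≈−u =
          −3u∉C (C-resp (x≈z//y z u (- u + - u) (trans (sym 2x≈z+u) (∙-cong x≈−u x≈−u))) z∈C)

        x∈C : C x
        x∈C = ≡.sym (¬rainbow⇒≡₂₃
          (¬rainbow-cong col-u z∈C refl (rf u z x (trans (comm u z) (sym 2x≈z+u))))
          (≢-sym c≢a) (≢-sym col-x≢a))

        col-w≢a : col w ≢ a
        col-w≢a col-w with class-u w col-w
        ... | inj₁ w≈u  = z∉A (≡.trans (col-resp z≈−u) col-−u)
          where
          z≈−u : z ≈ - u
          z≈−u = trans (x≈z//y z (u + u) u w≈u) (trans (∙-congˡ −2u≈−u−u) (\\-leftDividesˡ u (- u)))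
        ... | inj₂ w≈−u = −3u∉C (C-resp z≈−3u z∈C)
          where
          z≈−3u : z ≈ - u + - u + - u
          z≈−3u = trans (x≈z//y z (u + u) (- u) w≈−u)
                        (trans (∙-congˡ −2u≈−u−u) (sym (assoc (- u) (- u) (- u))))

    module G⁺ = Generator e e≉0 col-e col-−e class-e
    module G⁻ = Generator (- e) −e≉0 col-−e col-−−e class-−e

    open Stabiliser xs complete C C-resp public renaming (Stab to H)
    open IsSubgroup stab-isSubgroup
    open SubgroupProperties stab-isSubgroup

    2e∈H : H (e + e)
    2e∈H = stab-intro λ z → mk⇔ (C+2e z) (C-resp (z+2e−2e≈z z) ∘ C−2e (z + (e + e)))
      where
      −e−e≈−2e : - e + - e ≈ - (e + e)
      −e−e≈−2e = ⁻¹-∙-comm e e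

      z+2e−2e≈z : ∀ z → z + (e + e) + (- e + - e) ≈ z
      z+2e−2e≈z z = trans (∙-congˡ −e−e≈−2e) (//-rightDividesʳ (e + e) z)

      C+2e : ∀ z → C z → C (z + (e + e))
      C+2e = G⁺.C+double G⁻.triple∉C

      C−2e : ∀ z → C z → C (z + (- e + - e))
      C−2e = G⁻.C+double (G⁺.triple∉C ∘ C-resp (∙-cong (∙-cong ie ie) ie))
        where
        ie : - - e ≈ e
        ie = ⁻¹-involutive e

    e∈H : H e
    e∈H = halve-closed stab-isSubgroup 2e∈H

    −e∈H : H (- e)
    −e∈H = neg-closed e∈H

    A⊆H : ∀ x → col x ≡ a → H x
    A⊆H x col-x with class-e x col-x
    ... | inj₁ x≈e  = resp (sym x≈e) e∈H
    ... | inj₂ x≈−e = resp (sym x≈−e) −e∈H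

    H-proper : ∃ λ x → ¬ H x
    H-proper = - p + e , λ h∈H → c≢a (≡.trans (≡.sym (e∈C h∈H)) col-e)
      where
      w p : Carrier
      w = proj₁ (nonempty₀ c)
      p = w + - g

      p∈C : C p
      p∈C = ≡.trans (col₀-resp (//-rightDividesˡ g w)) (proj₂ (nonempty₀ c))

      e∈C : H (- p + e) → C e
      e∈C h∈H = C-resp (\\-leftDividesˡ p e) (to (stab-elim h∈H p) p∈C)

    col-∉H-≢a : ∀ {x} → ¬ H x → col x ≢ a
    col-∉H-≢a {x} x∉H col-x = x∉H (A⊆H x col-x)

    -- Off H the colour is never a, so it is determined by membership in the H-periodic set C.
    col-∉H-periodic : ∀ {x h} → ¬ H x → H h → col (x + h) ≡ col x
    col-∉H-periodic {x} x∉H h∈H with col x ≟ c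
    ... | yes x∈C = ≡.trans (to (stab-elim h∈H x) x∈C) (≡.sym x∈C)
    ... | no  x∉C = ≢₂-unique (≢-sym c≢a) (col-∉H-≢a x∉H) x∉C
                              (col-∉H-≢a (∉-+-closed x∉H h∈H)) (x∉C ∘ from (stab-elim h∈H x))

    col-∉H-neg : ∀ {x} → ¬ H x → col (- x) ≡ col x
    col-∉H-neg {x} x∉H = ≡.sym (≡.trans col-x≡col-y (col-∉H-periodic −x∉H 2e∈H))
      where
      −x∉H : ¬ H (- x)
      −x∉H = ∉-neg-closed x∉H

      y : Carrier
      y = - x + (e + e)

      col-x≡col-y : col x ≡ col y
      col-x≡col-y = ¬rainbow⇒≡₁₂
        (¬rainbow-cong refl refl col-e (rf x y e (\\-leftDividesˡ x (e + e))))
        (col-∉H-≢a x∉H) (col-∉H-≢a (∉-+-closed −x∉H 2e∈H))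

    col-∉H-double : ∀ {x} → ¬ H x → col (x + x) ≡ col x
    col-∉H-double {x} x∉H =
      ≡.trans (col-resp (sym w−e≈2x)) (≡.trans (col-∉H-periodic w∉H −e∈H) col-w≡col-x)
      where
      w : Carrier
      w = x + x + e

      w−e≈2x : w + - e ≈ x + x
      w−e≈2x = //-rightDividesʳ e (x + x)

      w∉H : ¬ H w
      w∉H w∈H = x∉H (halve-closed stab-isSubgroup (resp w−e≈2x (+-closed w∈H −e∈H)))

      col-w≡col-x : col w ≡ col x
      col-w≡col-x = ¬rainbow⇒≡₂₃
        (¬rainbow-cong col-−e refl refl (rf (- e) w x (trans (comm (- e) w) w−e≈2x)))
        (≢-sym (col-∉H-≢a w∉H)) (≢-sym (col-∉H-≢a x∉H))

    Outside : Fin 3 → Carrier → Set ℓ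
    Outside t x = col x ≡ t × ¬ H x

    outside-periodic : ∀ t → Periodic G H (Outside t)
    outside-periodic t x h (col-x , x∉H) h∈H =
      ≡.trans (col-∉H-periodic x∉H h∈H) col-x , ∉-+-closed x∉H h∈H

    outside-symmetric : ∀ t → Symmetric G (Outside t)
    outside-symmetric t =
      (λ x (col-x , x∉H) → ≡.trans (col-∉H-neg x∉H) col-x , ∉-neg-closed x∉H) ,
      (λ x (col-−x , −x∉H) → let x∉H = −x∉H ∘ neg-closed in
        ≡.trans (≡.sym (col-∉H-neg x∉H)) col-−x , x∉H)

    half-∉H : ∀ {y} → ¬ H y → ¬ H (half y)
    half-∉H {y} y∉H ½y∈H = y∉H (resp (half+half y) (+-closed ½y∈H ½y∈H))

    outside-doubling : ∀ t → DoublingInvariant G (Outside t)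
    outside-doubling t =
      (λ x (col-x , x∉H) → ≡.trans (col-∉H-double x∉H) col-x , x∉H ∘ halve-closed stab-isSubgroup) ,
      (λ y (col-y , y∉H) →
        half y ,
        (≡.trans (≡.sym (col-∉H-double (half-∉H y∉H))) (≡.trans (col-resp (half+half y)) col-y) ,
         half-∉H y∉H) ,
        half+half y)

    regular : HRegular G H col₀
    regular = g , a , b , c , (≢-sym b≢a , ≢-sym c≢a , ≢-sym c≢b) , A⊆H , (λ x y z _ _ _ → rf x y z) ,
              outside-periodic b , outside-periodic c ,
              outside-symmetric b , outside-doubling b , outside-symmetric c , outside-doubling c

lemma5 : {c ℓ : Level} (G : AbelianGroup c ℓ) → FiniteOddOrder G →
    (col : Coloring G) → RainbowFree G (proj₁ col) → AllClassesNonEmpty G (proj₁ col) →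
    (a : Fin 3) → ClassHasSize2 G (proj₁ col) a →
    Σ (AbelianGroup.Carrier G → Set ℓ) λ H → IsProperSubgroup G H × HRegular G H (proj₁ col)
lemma5 G (k , order@(xs , _ , complete , _)) (col , col-resp) rf nonempty a
       (x₀ , y₀ , x₀≉y₀ , col-x₀ , col-y₀ , class-a) =
  H , (stab-isSubgroup , H-proper) , regular
  where
  open TwoElementClass G k (order-annihilates G order) xs complete
         col col-resp rf nonempty a x₀ y₀ x₀≉y₀ col-x₀ col-y₀ class-a
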